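{- Let $\mathcal I$ be a small step alternating pushdown system and let $\mathcal I_{\neg}$ and $\mathcal I'_{\neg}$ be as defined below. For every rule of $\mathcal I'_{\neg}$ of the form $\frac{\neg B_1\ \cdots\ \neg B_q}{\neg A}$, there exists a rule of $\mathcal I_{\neg}$ of the form $\frac{\neg C_1\ \cdots\ \neg C_p}{\neg A}$ (with the same conclusion $\neg A$) such that each of $\neg C_1,\dots,\neg C_p$ is provable in $\mathcal I'_{\neg}$ from the hypotheses $\neg B_1,\dots,\neg B_q$.
   Context: Fix a language with finitely many unary predicate symbols (states), finitely many unary function symbols (stack symbols), a constant $\varepsilon$ and a variable $x$. Words are closed terms $\gamma_1(\cdots\gamma_n(\varepsilon))$; terms are words or $wx$ (i.e. $\gamma_1(\cdots\gamma_n(x))$); configurations are closed atomic propositions $P(w)$. Besides atomic propositions we use formal negations $\neg A$. For an inference system $\mathcal J$ (rules with finitely many premises, each premise and the conclusion being an atomic proposition or its negation), a proof of a proposition $C$ (possibly containing $x$) from hypotheses $H_1,\dots,H_k$ is a finite tree with root $C$ each of whose leaves is either one of the $H_i$ or is justified by a premise-free rule, and each of whose nodes not labeled by a hypothesis is labeled $\sigma B$ with children $\sigma A_1,\dots,\sigma A_n$ for some rule $\frac{A_1\cdots A_n}{B}\in\mathcal J$ and substitution $\sigma$ replacing $x$ by a term. Rule types: an introduction rule is $\frac{P_1(x)\cdots P_n(x)}{Q(\gamma x)}$ ($\gamma$ a stack symbol, $n\ge0$) or $\frac{}{Q(\varepsilon)}$; an elimination rule is $\frac{P_1(\gamma x)\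 P_2(x)\cdots P_n(x)}{Q(x)}$ ($n\ge1$); a neutral rule is $\frac{P_1(x)\cdots P_n(x)}{Q(x)}$ ($n\ge0$). A small step alternating pushdown system is a finite set of introduction, elimination and neutral rules; premises of rules are regarded as sets. Saturation: $\mathcal I_s$ is the smallest set of rules containing $\mathcal I$ and closed under (1) from an introduction rule $\frac{P_1(x)\cdots P_m(x)}{Q_1(\gamma x)}$ and an elimination rule $\frac{Q_1(\gamma x)\ Q_2(x)\cdots Q_n(x)}{R(x)}$, add $\frac{P_1(x)\cdots P_m(x)\ Q_2(x)\cdots Q_n(x)}{R(x)}$; (2) from introduction rules $\frac{P^i_1(x)\cdots P^i_{m_i}(x)}{Q_i(\gamma x)}$ ($i=1..n$, same $\gamma$) and a neutral rule $\frac{Q_1(x)\cdots Q_n(x)}{R(x)}$ ($n\ge0$), add $\frac{P^1_1(x)\cdots P^n_{m_n}(x)}{R(\gamma x)}$ (all premises together; for $n=0$, $\frac{}{R(\gamma x)}$ for every $\gamma$); (3) from introduction rules $\frac{}{Q_i(\varepsilon)}$ ($i=1..n$) and a neutral rule $\frac{Q_1(x)\cdots Q_n(x)}{R(x)}$ ($n\ge0$), add $\frac{}{R(\varepsilon)}$. $\mathcal I'$ is obtained from $\mathcal I_s$ by removing all elimination and neutral rules. For a small step system $\mathcal J$: $\tilde{\mathcal J}$ keeps the introduction rules of $\mathcal J$ and replaces each neutral or elimination rule (conclusion $P(x)$) by its instance with $x:=\varepsilon$ and its instances with $x:=\gamma x$ for every stack symbol $\gamma$; $\mathcal C$ is the set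 of all $P(\varepsilon)$, $P(\gamma x)$. Then $\mathcal J_{\neg}$ consists of the rules of $\mathcal J$ together with, for each $B\in\mathcal C$, letting $r_1,\dots,r_n$ ($n\ge0$) be the rules of $\tilde{\mathcal J}$ with conclusion $B$ and $A^i_1,\dots,A^i_{m_i}$ the premises of $r_i$, all rules $\frac{\neg A^1_{j_1}\ \cdots\ \neg A^n_{j_n}}{\neg B}$ for $1\le j_i\le m_i$ (the single rule $\frac{}{\neg B}$ if $n=0$). $\mathcal I_{\neg}$ and $\mathcal I'_{\neg}$ are this construction applied to $\mathcal J=\mathcal I$ and $\mathcal J=\mathcal I'$ respectively. -}

module Defs where

open import Data.Nat using (ℕ; zero; suc)
open import Data.Bool using (Bool; true; false)
open import Data.Fin using (Fin; zero; suc)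
open import Data.Fin.Subset using (Subset; _∪_; ⊥; inside; outside) renaming (_∈_ to _∈ₛ_)
open import Data.Vec using (Vec; []; _∷_)
open import Data.List using (List; []; _∷_; map; _++_)
open import Data.List.Membership.Propositional using () renaming (_∈_ to _∈ₗ_)
open import Data.List.Relation.Unary.All using (All)
open import Data.Product using (Σ; _×_; _,_; ∃)
open import Data.Sum using (_⊎_)
open import Relation.Binary.PropositionalEquality using (_≡_)

bigU : ∀ {n m} → Subset n → (Fin n → Subset m) → Subset m
bigU {zero}  []            f = ⊥
bigU {suc n} (true  ∷ T) f = f zero ∪ bigU T (λ q → f (suc q))
bigU {suc n} (false ∷ T) f = bigU T (λ q → f (suc q))

members : ∀ {n} → Subset n → List (Fin n)
members []           = []
members (true  ∷ S) = zero ∷ map suc (members S)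
members (false ∷ S) = map suc (members S)

-- nP states (unary predicate symbols), nG stack symbols (unary function symbols)
module APDS (nP nG : ℕ) where

  State = Fin nP
  Stack = Fin nG

  -- A term: a word γ₁(⋯γₙ(ε)) when hasVar = false, or γ₁(⋯γₙ(x)) when hasVar = true.
  record Term : Set where
    constructor term
    field
      word   : List Stack
      hasVar : Bool
  open Term public

  εT : Term
  εT = term [] false

  xT : Term
  xT = term [] true

  γxT : Stack → Term
  γxT γ = term (γ ∷ []) true

  record Atom : Set where
    constructor atom
    field
      pred : State
      arg  : Term

  data Prop : Set where
    pos : Atom → Prop
    neg : Atom → Prop

  record Rule : Set where
    constructor rule
    field
      prems : List Prop
      concl : Prop
  open Rule public

  substT : Term → Term → Term
  substT σ (term w false) = term w false
  substT σ (term w true)  = term (w ++ word σ) (hasVar σ)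

  substA : Term → Atom → Atom
  substA σ (atom P t) = atom P (substT σ t)

  substP : Term → Prop → Prop
  substP σ (pos a) = pos (substA σ a)
  substP σ (neg a) = neg (substA σ a)

  substR : Term → Rule → Rule
  substR σ (rule ps c) = rule (map (substP σ) ps) (substP σ c)

  data Proof (J : Rule → Set) (H : List Prop) : Prop → Set where
    hyp : ∀ {C} → C ∈ₗ H → Proof J H C
    app : (r : Rule) (σ : Term) → J r →
          All (Proof J H) (map (substP σ) (prems r)) →
          Proof J H (substP σ (concl r))

  data SRule : Set where
    -- P₁(x)⋯Pₙ(x) / Q(γx)
    intro  : Stack → Subset nP → State → SRule
    -- / Q(ε)
    introε : State → SRule
    -- P₁(γx) P₂(x)⋯Pₙ(x) / Q(x)     (elim P₁ γ {P₂..Pₙ} Q)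
    elim   : State → Stack → Subset nP → State → SRule
    -- P₁(x)⋯Pₙ(x) / Q(x)
    neut   : Subset nP → State → SRule

  data IsIntro : SRule → Set where
    isIntro  : ∀ {γ S Q} → IsIntro (intro γ S Q)
    isIntroε : ∀ {Q} → IsIntro (introε Q)

  data IsElimOrNeut : SRule → Set where
    isElim : ∀ {P γ S Q} → IsElimOrNeut (elim P γ S Q)
    isNeut : ∀ {S Q} → IsElimOrNeut (neut S Q)

  atX : Subset nP → List Prop
  atX S = map (λ p → pos (atom p xT)) (members S)

  toRule : SRule → Rule
  toRule (intro γ S Q)  = rule (atX S) (pos (atom Q (γxT γ)))
  toRule (introε Q)     = rule [] (pos (atom Q εT))
  toRule (elim P γ S Q) = rule (pos (atom P (γxT γ)) ∷ atX S) (pos (atom Q xT))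
  toRule (neut S Q)     = rule (atX S) (pos (atom Q xT))

  data Sat (I : List SRule) : SRule → Set where
    base : ∀ {r} → r ∈ₗ I → Sat I r
    sat1 : ∀ {γ S Q T R} → Sat I (intro γ S Q) → Sat I (elim Q γ T R) →
           Sat I (neut (S ∪ T) R)
    sat2 : ∀ {γ T R} (f : State → Subset nP) →
           (∀ Q → Q ∈ₛ T → Sat I (intro γ (f Q) Q)) →
           Sat I (neut T R) →
           Sat I (intro γ (bigU T f) R)
    sat3 : ∀ {T R} →
           (∀ Q → Q ∈ₛ T → Sat I (introε Q)) →
           Sat I (neut T R) →
           Sat I (introε R)

  I' : List SRule → SRule → Set
  I' I r = Sat I r × IsIntro r

  data Tilde (J : SRule → Set) : Rule → Set where
    keep : ∀ {r} → J r → IsIntro r → Tilde J (toRule r)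
    instε : ∀ {r} → J r → IsElimOrNeut r → Tilde J (substR εT (toRule r))
    instγ : ∀ {r} (γ : Stack) → J r → IsElimOrNeut r → Tilde J (substR (γxT γ) (toRule r))

  data InC : Atom → Set where
    cε : ∀ P → InC (atom P εT)
    cγ : ∀ P γ → InC (atom P (γxT γ))

  -- 𝒥¬ : the rules of 𝒥 together with the negative rules
  --   ¬A¹_{j₁} ⋯ ¬Aⁿ_{jₙ} / ¬B, one premise chosen (by f) from each rule of 𝒥̃
  --   with conclusion B; the premise set is exactly the set of chosen premises.
  data Neg (J : SRule → Set) : Rule → Set where
    pRule : ∀ {r} → J r → Neg J (toRule r)
    nRule : (B : Atom) → InC B → (f : Rule → Atom) →
            (∀ r → Tilde J r → concl r ≡ pos B → pos (f r) ∈ₗ prems r) →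
            (N : List Atom) →
            (∀ a → a ∈ₗ N → Σ Rule λ r → Tilde J r × concl r ≡ pos B × a ≡ f r) →
            (∀ r → Tilde J r → concl r ≡ pos B → f r ∈ₗ N) →
            Neg J (rule (map neg N) (neg B))

  INeg : List SRule → Rule → Set
  INeg I = Neg (λ r → r ∈ₗ I)

  I'Neg : List SRule → Rule → Set
  I'Neg I = Neg (I' I)

module Submission where

-- Fix the hypotheses N = B₁ ⋯ B_q.  Call an atom R(t), t a stack word over ε or x,
-- refuted when R(ε) has no saturated rule  / R(ε),  when R(x) ∈ N, and, for t = γt',
-- when every saturated introduction rule  P₁(x)⋯Pₙ(x) / R(γx)  has a premise Pᵢ with
-- Pᵢ(t') refuted.  By induction on t, refuted atoms have negations provable in 𝓘'¬
-- (the negative rule for R(γx) choosing the refuted premises, instantiated at x := t').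
-- The given rule makes its conclusion A ∈ 𝒞 refuted.  Saturation rules (1)-(3) show
-- that refutation propagates backwards: every rule of 𝓘~ (Tilde) concluding a refuted A ∈ 𝒞
-- has a refuted premise.  Choosing such a premise from each of them gives the rule of 𝓘¬.
--
-- Everything is constructive: choosing premises requires refutation to be decidable,
-- which rests on the decidability of membership in the saturation 𝓘ₛ, obtained as the
-- fixed point of one-step saturation over the finite type of small step rules.

open import Defs
open import Data.Nat using (ℕ; zero; suc; _≤_; _<_; s≤s; z≤n)
open import Data.Nat.Properties using (≤-trans; m≤n⇒m≤1+n; <-irrefl)
open import Data.Bool using (Bool; true; false; T; _∨_; if_then_else_)
open import Data.Bool.Properties using (T-∨) renaming (_≟_ to _≟ᵇ_)
open import Data.Fin using (Fin; zero; suc)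
open import Data.Fin.Properties using (any?; all?) renaming (_≟_ to _≟ᶠ_)
open import Data.Fin.Subset using (Subset; _∪_) renaming (_∈_ to _∈ₛ_; ⊥ to ∅)
open import Data.Fin.Subset.Properties using (anySubset?; x∈p∪q⁻; ∉⊥) renaming (_∈?_ to _∈ₛ?_)
open import Data.Vec using ([]; _∷_; here; there)
open import Data.Vec.Properties using () renaming (≡-dec to ≡-decᵛ)
open import Data.List using (List; []; _∷_; map; _++_; length; allFin; cartesianProduct; concatMap; filter)
open import Data.List.Properties using (map-injective) renaming (≡-dec to ≡-decˡ)
open import Data.List.Membership.Propositional using (_∈_; find; lose)
open import Data.List.Membership.DecPropositional using () renaming (_∈?_ to member?)
open import Data.List.Membership.Propositional.Properties
  using (∈-map⁺; ∈-map⁻; ∈-++⁺ˡ; ∈-++⁺ʳ; ∈-allFin; ∈-cartesianProduct⁺; ∈-concatMap⁺; ∈-concatMap⁻;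
         ∈-map∘filter⁺; ∈-map∘filter⁻)
open import Data.List.Relation.Unary.Any using (Any; here; there)
open import Data.List.Relation.Unary.All using (All; []) renaming (all? to allᴸ?; lookup to lookupᴬ; map to mapᴬ; tabulate to tabulateᴬ)
open import Data.List.Relation.Unary.All.Properties using (¬All⇒Any¬; map⁺; all-filter)
open import Data.Product using (Σ; ∃; _×_; _,_; proj₁; proj₂)
open import Data.Product.Properties using () renaming (≡-dec to ≡-dec×)
open import Data.Sum using (_⊎_; inj₁; inj₂; [_,_])
open import Data.Sum.Properties using () renaming (≡-dec to ≡-dec⊎)
open import Data.Empty using (⊥; ⊥-elim)
open import Function using (Equivalence)
open import Relation.Nullary using (Dec; yes; no; ¬_; ¬?; _×-dec_; _→-dec_; map′)
open import Relation.Nullary.Decidable using (T?; isYes; decidable-stable; toWitness; fromWitness)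
open import Relation.Unary using (Decidable)
open import Relation.Binary.Definitions using (DecidableEquality)
open import Relation.Binary.PropositionalEquality using (_≡_; refl; sym; trans; cong; cong₂; subst)

record Finite (A : Set) : Set where
  field
    _≟_      : DecidableEquality A
    elements : List A
    complete : ∀ x → x ∈ elements

open Finite

finiteFin : ∀ n → Finite (Fin n)
finiteFin n = record { _≟_ = _≟ᶠ_ ; elements = allFin n ; complete = ∈-allFin }

subsets : ∀ n → List (Subset n)
subsets zero    = [] ∷ []
subsets (suc n) = map (true ∷_) (subsets n) ++ map (false ∷_) (subsets n)

subsets-complete : ∀ {n} (S : Subset n) → S ∈ subsets n
subsets-complete []          = here refl
subsets-complete (true ∷ S)  = ∈-++⁺ˡ (∈-map⁺ (true ∷_) (subsets-complete S))
subsets-complete {suc n} (false ∷ S) =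
  ∈-++⁺ʳ (map (true ∷_) (subsets n)) (∈-map⁺ (false ∷_) (subsets-complete S))

finiteSubset : ∀ n → Finite (Subset n)
finiteSubset n = record { _≟_ = ≡-decᵛ _≟ᵇ_ ; elements = subsets n ; complete = subsets-complete }

finite× : ∀ {A B} → Finite A → Finite B → Finite (A × B)
finite× FA FB = record
  { _≟_      = ≡-dec× (_≟_ FA) (_≟_ FB)
  ; elements = cartesianProduct (elements FA) (elements FB)
  ; complete = λ (a , b) → ∈-cartesianProduct⁺ (complete FA a) (complete FB b)
  }

finite⊎ : ∀ {A B} → Finite A → Finite B → Finite (A ⊎ B)
finite⊎ FA FB = record
  { _≟_      = ≡-dec⊎ (_≟_ FA) (_≟_ FB)
  ; elements = map inj₁ (elements FA) ++ map inj₂ (elements FB)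
  ; complete = λ { (inj₁ a) → ∈-++⁺ˡ (∈-map⁺ inj₁ (complete FA a))
                 ; (inj₂ b) → ∈-++⁺ʳ (map inj₁ (elements FA)) (∈-map⁺ inj₂ (complete FB b)) }
  }

finiteRetract : ∀ {A B} (to : A → B) (from : B → A) → (∀ x → from (to x) ≡ x) → Finite B → Finite A
finiteRetract to from from∘to FB = record
  { _≟_      = λ x y → map′ injective (cong to) (_≟_ FB (to x) (to y))
  ; elements = map from (elements FB)
  ; complete = λ x → subst (_∈ map from (elements FB)) (from∘to x) (∈-map⁺ from (complete FB (to x)))
  }
  where
  injective : ∀ {x y} → to x ≡ to y → x ≡ y
  injective {x} {y} e = trans (sym (from∘to x)) (trans (cong from e) (from∘to y))

allOrCounterexample : ∀ {A} {P : A → Set} → Finite A → Decidable P → (∀ x → P x) ⊎ ∃ λ x → ¬ P x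
allOrCounterexample FA P? with allᴸ? P? (elements FA)
... | yes all = inj₁ λ x → lookupᴬ all (complete FA x)
... | no ¬all = let (x , _ , ¬px) = find (¬All⇒Any¬ P? (elements FA) ¬all) in inj₂ (x , ¬px)

¬→-split : ∀ {A B : Set} → Dec A → ¬ (A → B) → A × ¬ B
¬→-split (yes a) ¬a→b = a , λ b → ¬a→b (λ _ → b)
¬→-split (no ¬a) ¬a→b = ⊥-elim (¬a→b (λ a → ⊥-elim (¬a a)))

count : ∀ {A : Set} → (A → Bool) → List A → ℕ
count X []       = 0
count X (u ∷ us) = if X u then suc (count X us) else count X us

count≤length : ∀ {A : Set} (X : A → Bool) (us : List A) → count X us ≤ length us
count≤length X [] = z≤n
count≤length X (u ∷ us) with X u
... | true  = s≤s (count≤length X us)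
... | false = m≤n⇒m≤1+n (count≤length X us)

_⊆ᵇ_ : ∀ {A : Set} → (A → Bool) → (A → Bool) → Set
X ⊆ᵇ Y = ∀ u → T (X u) → T (Y u)

count-mono : ∀ {A : Set} {X Y : A → Bool} → X ⊆ᵇ Y → (us : List A) → count X us ≤ count Y us
count-mono X⊆Y [] = z≤n
count-mono {X = X} {Y} X⊆Y (u ∷ us) with X u | Y u | X⊆Y u
... | true  | true  | _ = s≤s (count-mono X⊆Y us)
... | true  | false | h = ⊥-elim (h _)
... | false | true  | _ = m≤n⇒m≤1+n (count-mono X⊆Y us)
... | false | false | _ = count-mono X⊆Y us

count-strict : ∀ {A : Set} {X Y : A → Bool} → X ⊆ᵇ Y → (us : List A) {u : A} →
               u ∈ us → T (Y u) → ¬ T (X u) → count X us < count Y us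
count-strict {X = X} {Y} X⊆Y (v ∷ us) (here refl) Yu ¬Xu with X v | Y v
... | true  | _     = ⊥-elim (¬Xu _)
... | false | true  = s≤s (count-mono X⊆Y us)
count-strict {X = X} {Y} X⊆Y (v ∷ us) (there u∈us) Yu ¬Xu with X v | Y v | X⊆Y v
... | true  | true  | _ = s≤s (count-strict X⊆Y us u∈us Yu ¬Xu)
... | true  | false | h = ⊥-elim (h _)
... | false | true  | _ = m≤n⇒m≤1+n (count-strict X⊆Y us u∈us Yu ¬Xu)
... | false | false | _ = count-strict X⊆Y us u∈us Yu ¬Xu

-- Iterating an inflationary operator on Boolean predicates over a finite type,
-- starting from the empty predicate, reaches a post-fixed point: each step either
-- stabilises or adds an element, and there are only finitely many elements to add.
module Stabilisation {A : Set} (FA : Finite A) (F : (A → Bool) → A → Bool)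
                     (inflationary : ∀ X → X ⊆ᵇ F X) where

  iterate : ℕ → A → Bool
  iterate zero    _ = false
  iterate (suc k) = F (iterate k)

  PostFixed : (A → Bool) → Set
  PostFixed X = F X ⊆ᵇ X

  growth : ∀ k → (Σ ℕ λ j → PostFixed (iterate j)) ⊎ (k ≤ count (iterate k) (elements FA))
  growth zero = inj₂ z≤n
  growth (suc k) with growth k
  ... | inj₁ fixed = inj₁ fixed
  ... | inj₂ k≤count
    with allOrCounterexample FA (λ u → T? (iterate (suc k) u) →-dec T? (iterate k u))
  ... | inj₁ fixed = inj₁ (k , fixed)
  ... | inj₂ (u , ¬fixed) =
    let (new , ¬old) = ¬→-split (T? _) ¬fixed in
    inj₂ (≤-trans (s≤s k≤count)
           (count-strict (inflationary (iterate k)) (elements FA) (complete FA u) new ¬old))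

  stabilises : Σ ℕ λ k → PostFixed (iterate k)
  stabilises with growth (suc (length (elements FA)))
  ... | inj₁ fixed = fixed
  ... | inj₂ n<count = ⊥-elim (<-irrefl refl (≤-trans n<count (count≤length _ (elements FA))))

bigU⁻ : ∀ {n m} (T : Subset n) (f : Fin n → Subset m) {x : Fin m} →
        x ∈ₛ bigU T f → Σ (Fin n) λ q → q ∈ₛ T × x ∈ₛ f q
bigU⁻ []          f x∈ = ⊥-elim (∉⊥ x∈)
bigU⁻ (true ∷ T)  f x∈ with x∈p∪q⁻ (f zero) (bigU T (λ q → f (suc q))) x∈
... | inj₁ x∈f0 = zero , here , x∈f0
... | inj₂ x∈rest = let (q , q∈T , x∈fq) = bigU⁻ T (λ q → f (suc q)) x∈rest in suc q , there q∈T , x∈fq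
bigU⁻ (false ∷ T) f x∈ = let (q , q∈T , x∈fq) = bigU⁻ T (λ q → f (suc q)) x∈ in suc q , there q∈T , x∈fq

UnionOf : ∀ {n m} → Subset n → (Fin n → Subset m → Set) → Subset m → Set
UnionOf {n} {m} T P U = Σ (Fin n → Subset m) λ f → (∀ q → q ∈ₛ T → P q (f q)) × bigU T f ≡ U

-- Being such a union is decidable when the families are; this decides whether
-- saturation rule (2) produces a given introduction rule.
unionOf? : ∀ {n m} (T : Subset n) {P : Fin n → Subset m → Set} →
           (∀ q S → Dec (P q S)) → ∀ U → Dec (UnionOf T P U)
unionOf? [] P? U = map′ (λ e → (λ ()) , (λ _ ()) , e) (λ (_ , _ , e) → e) (≡-decᵛ _≟ᵇ_ ∅ U)
unionOf? (true ∷ T) P? U =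
  map′ (λ (S , pS , U' , (f , pf , e') , e) →
          (λ { zero → S ; (suc q) → f q }) ,
          (λ { zero _ → pS ; (suc q) (there q∈T) → pf q q∈T }) ,
          trans (cong (S ∪_) e') e)
       (λ (f , pf , e) → f zero , pf zero here , bigU T (λ q → f (suc q)) ,
          ((λ q → f (suc q)) , (λ q q∈T → pf (suc q) (there q∈T)) , refl) , e)
       (anySubset? λ S → P? zero S ×-dec anySubset? λ U' →
          unionOf? T (λ q → P? (suc q)) U' ×-dec ≡-decᵛ _≟ᵇ_ (S ∪ U') U)
unionOf? (false ∷ T) P? U =
  map′ (λ (f , pf , e) → (λ { zero → ∅ ; (suc q) → f q }) , (λ { zero () ; (suc q) (there q∈T) → pf q q∈T }) , e)
       (λ (f , pf , e) → (λ q → f (suc q)) , (λ q q∈T → pf (suc q) (there q∈T)) , e)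
       (unionOf? T (λ q → P? (suc q)) U)

members⁺ : ∀ {n} {S : Subset n} {R : Fin n} → R ∈ₛ S → R ∈ members S
members⁺ {S = true ∷ S}  here          = here refl
members⁺ {S = true ∷ S}  (there R∈S)   = there (∈-map⁺ suc (members⁺ R∈S))
members⁺ {S = false ∷ S} (there R∈S)   = ∈-map⁺ suc (members⁺ R∈S)

members⁻ : ∀ {n} (S : Subset n) {R : Fin n} → R ∈ members S → R ∈ₛ S
members⁻ (true ∷ S)  (here refl) = here
members⁻ (true ∷ S)  (there R∈)  with ∈-map⁻ suc R∈
... | (_ , R∈' , refl) = there (members⁻ S R∈')
members⁻ (false ∷ S) R∈ with ∈-map⁻ suc R∈
... | (_ , R∈' , refl) = there (members⁻ S R∈')

module _ {nP nG : ℕ} where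
  open APDS nP nG

  premiseˣ⁺ : {S : Subset nP} {R : State} → R ∈ₛ S → pos (atom R xT) ∈ atX S
  premiseˣ⁺ R∈S = ∈-map⁺ (λ p → pos (atom p xT)) (members⁺ R∈S)

  premise⁺ : (σ : Term) {S : Subset nP} {R : State} → R ∈ₛ S → pos (atom R σ) ∈ map (substP σ) (atX S)
  premise⁺ σ R∈S = ∈-map⁺ (substP σ) (premiseˣ⁺ R∈S)

  premise⁻ : (S : Subset nP) {a : Atom} → pos a ∈ atX S → Σ State λ R → R ∈ₛ S × a ≡ atom R xT
  premise⁻ S a∈ with ∈-map⁻ (λ p → pos (atom p xT)) a∈
  ... | (R , R∈ , refl) = R , members⁻ S R∈ , refl

  _≟ᵗ_ : DecidableEquality Term
  term w b ≟ᵗ term w' b' =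
    map′ (λ (e₁ , e₂) → cong₂ term e₁ e₂) (λ { refl → refl , refl }) (≡-decˡ _≟ᶠ_ w w' ×-dec (b ≟ᵇ b'))

  _≟ᵃ_ : DecidableEquality Atom
  atom P t ≟ᵃ atom P' t' =
    map′ (λ (e₁ , e₂) → cong₂ atom e₁ e₂) (λ { refl → refl , refl }) ((P ≟ᶠ P') ×-dec (t ≟ᵗ t'))

  isPos? : (p : Prop) (A : Atom) → Dec (p ≡ pos A)
  isPos? (pos a) A = map′ (cong pos) (λ { refl → refl }) (a ≟ᵃ A)
  isPos? (neg a) A = no λ ()

  SRuleCode : Set
  SRuleCode = (Stack × Subset nP × State) ⊎ State ⊎ (State × Stack × Subset nP × State) ⊎ (Subset nP × State)

  encodeRule : SRule → SRuleCode
  encodeRule (intro γ S Q)  = inj₁ (γ , S , Q)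
  encodeRule (introε Q)     = inj₂ (inj₁ Q)
  encodeRule (elim P γ S Q) = inj₂ (inj₂ (inj₁ (P , γ , S , Q)))
  encodeRule (neut S Q)     = inj₂ (inj₂ (inj₂ (S , Q)))

  decodeRule : SRuleCode → SRule
  decodeRule (inj₁ (γ , S , Q))                   = intro γ S Q
  decodeRule (inj₂ (inj₁ Q))                      = introε Q
  decodeRule (inj₂ (inj₂ (inj₁ (P , γ , S , Q)))) = elim P γ S Q
  decodeRule (inj₂ (inj₂ (inj₂ (S , Q))))         = neut S Q

  decode∘encode : ∀ u → decodeRule (encodeRule u) ≡ u
  decode∘encode (intro _ _ _)  = refl
  decode∘encode (introε _)     = refl
  decode∘encode (elim _ _ _ _) = refl
  decode∘encode (neut _ _)     = refl

  finiteSRule : Finite SRule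
  finiteSRule = finiteRetract encodeRule decodeRule decode∘encode
    (finite⊎ (finite× stacks (finite× sets states))
      (finite⊎ states (finite⊎ (finite× states (finite× stacks (finite× sets states))) (finite× sets states))))
    where
    states : Finite State
    states = finiteFin nP
    stacks : Finite Stack
    stacks = finiteFin nG
    sets : Finite (Subset nP)
    sets = finiteSubset nP

  -- Membership in the saturation is decidable: Sat I is the least fixed point of a
  -- one-step rule-application operator on the finite type of small step rules.
  module SaturationDecidable (I : List SRule) where

    OneStep : (SRule → Bool) → SRule → Set
    OneStep X (intro γ U R) = Σ (Subset nP) λ V → T (X (neut V R)) × UnionOf V (λ Q S → T (X (intro γ S Q))) U
    OneStep X (introε R)    = Σ (Subset nP) λ V → T (X (neut V R)) × (∀ Q → Q ∈ₛ V → T (X (introε Q)))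
    OneStep X (neut U R)    = Σ Stack λ γ → Σ (Subset nP) λ S → Σ State λ Q → Σ (Subset nP) λ V →
                                T (X (intro γ S Q)) × T (X (elim Q γ V R)) × S ∪ V ≡ U
    OneStep X (elim _ _ _ _) = ⊥

    oneStep? : ∀ X u → Dec (OneStep X u)
    oneStep? X (intro γ U R) = anySubset? λ V → T? (X (neut V R)) ×-dec unionOf? V (λ Q S → T? (X (intro γ S Q))) U
    oneStep? X (introε R)    = anySubset? λ V → T? (X (neut V R)) ×-dec all? (λ Q → (Q ∈ₛ? V) →-dec T? (X (introε Q)))
    oneStep? X (neut U R)    = any? λ γ → anySubset? λ S → any? λ Q → anySubset? λ V →
                                 T? (X (intro γ S Q)) ×-dec T? (X (elim Q γ V R)) ×-dec ≡-decᵛ _≟ᵇ_ (S ∪ V) U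
    oneStep? X (elim _ _ _ _) = no λ ()

    _∈I? : (u : SRule) → Dec (u ∈ I)
    u ∈I? = member? (Finite._≟_ finiteSRule) u I

    next : (SRule → Bool) → SRule → Bool
    next X u = X u ∨ (isYes (u ∈I?) ∨ isYes (oneStep? X u))

    inflationary : ∀ X → X ⊆ᵇ next X
    inflationary X u Xu = Equivalence.from T-∨ (inj₁ Xu)

    open Stabilisation finiteSRule next inflationary

    oneStep-sound : ∀ {X} → (∀ u → T (X u) → Sat I u) → ∀ u → OneStep X u → Sat I u
    oneStep-sound sound (intro γ U R) (V , neutV , f , intros , refl) =
      sat2 f (λ Q Q∈V → sound _ (intros Q Q∈V)) (sound _ neutV)
    oneStep-sound sound (introε R) (V , neutV , intros) = sat3 (λ Q Q∈V → sound _ (intros Q Q∈V)) (sound _ neutV)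
    oneStep-sound sound (neut U R) (γ , S , Q , V , introS , elimS , refl) = sat1 (sound _ introS) (sound _ elimS)

    iterate-sound : ∀ k u → T (iterate k u) → Sat I u
    iterate-sound (suc k) u holds with Equivalence.to (T-∨ {iterate k u}) holds
    ... | inj₁ old = iterate-sound k u old
    ... | inj₂ new with Equivalence.to (T-∨ {isYes (u ∈I?)}) new
    ... | inj₁ u∈I = base (toWitness {a? = u ∈I?} u∈I)
    ... | inj₂ step = oneStep-sound (iterate-sound k) u (toWitness {a? = oneStep? (iterate k) u} step)

    next-base : ∀ X {u} → u ∈ I → T (next X u)
    next-base X {u} u∈I =
      Equivalence.from (T-∨ {X u}) (inj₂ (Equivalence.from T-∨ (inj₁ (fromWitness {a? = u ∈I?} u∈I))))

    next-step : ∀ X {u} → OneStep X u → T (next X u)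
    next-step X {u} step =
      Equivalence.from (T-∨ {X u}) (inj₂ (Equivalence.from (T-∨ {isYes (u ∈I?)}) (inj₂ (fromWitness {a? = oneStep? X u} step))))

    postFixed-complete : ∀ {X} → PostFixed X → ∀ {u} → Sat I u → T (X u)
    postFixed-complete {X} closed (base u∈I) = closed _ (next-base X u∈I)
    postFixed-complete {X} closed (sat1 {γ} {S} {Q} {V} introS elimS) = closed _ (next-step X
      (γ , S , Q , V , postFixed-complete closed introS , postFixed-complete closed elimS , refl))
    postFixed-complete {X} closed (sat2 {T = V} f intros neutV) = closed _ (next-step X
      (V , postFixed-complete closed neutV , f , (λ Q Q∈V → postFixed-complete closed (intros Q Q∈V)) , refl))
    postFixed-complete {X} closed (sat3 {V} intros neutV) = closed _ (next-step X
      (V , postFixed-complete closed neutV , (λ Q Q∈V → postFixed-complete closed (intros Q Q∈V))))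

    sat? : ∀ u → Dec (Sat I u)
    sat? u with stabilises
    ... | (k , closed) = map′ (iterate-sound k u) (postFixed-complete closed) (T? (iterate k u))

  firstPremise : {E : Atom → Set} → Decidable E → List Prop → Atom → Atom
  firstPremise E? []           d = d
  firstPremise E? (neg _ ∷ ps) d = firstPremise E? ps d
  firstPremise E? (pos a ∷ ps) d with E? a
  ... | yes _ = a
  ... | no _  = firstPremise E? ps d

  firstPremise-spec : {E : Atom → Set} (E? : Decidable E) (ps : List Prop) (d : Atom) →
                      (Σ Atom λ a → pos a ∈ ps × E a) →
                      pos (firstPremise E? ps d) ∈ ps × E (firstPremise E? ps d)
  firstPremise-spec E? (neg _ ∷ ps) d (a , there a∈ , Ea) =
    let (c∈ , Ec) = firstPremise-spec E? ps d (a , a∈ , Ea) in there c∈ , Ec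
  firstPremise-spec E? (pos b ∷ ps) d (a , a∈ , Ea) with E? b
  ... | yes Eb = here refl , Eb
  ... | no ¬Eb with a∈
  ...   | here refl = ⊥-elim (¬Eb Ea)
  ...   | there a∈' = let (c∈ , Ec) = firstPremise-spec E? ps d (a , a∈' , Ea) in there c∈ , Ec

  tilde-I'-γ : ∀ {I r γ Q} → Tilde (I' I) r → concl r ≡ pos (atom Q (γxT γ)) →
               Σ (Subset nP) λ V → Sat I (intro γ V Q) × r ≡ toRule (intro γ V Q)
  tilde-I'-γ (keep (s , _) isIntro) refl = _ , s , refl
  tilde-I'-γ (keep _ isIntroε) ()
  tilde-I'-γ (instε (_ , ()) isElim) _
  tilde-I'-γ (instε (_ , ()) isNeut) _
  tilde-I'-γ (instγ _ (_ , ()) isElim) _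
  tilde-I'-γ (instγ _ (_ , ()) isNeut) _

  tilde-I'-ε : ∀ {I r Q} → Tilde (I' I) r → concl r ≡ pos (atom Q εT) → Sat I (introε Q)
  tilde-I'-ε (keep (s , _) isIntroε) refl = s
  tilde-I'-ε (keep _ isIntro) ()
  tilde-I'-ε (instε (_ , ()) isElim) _
  tilde-I'-ε (instε (_ , ()) isNeut) _
  tilde-I'-ε (instγ _ (_ , ()) isElim) _
  tilde-I'-ε (instγ _ (_ , ()) isNeut) _

  instances : SRule → List Rule
  instances u = substR εT (toRule u) ∷ map (λ γ → substR (γxT γ) (toRule u)) (allFin nG)

  tildeRules : SRule → List Rule
  tildeRules (intro γ S Q)    = toRule (intro γ S Q) ∷ []
  tildeRules (introε Q)       = toRule (introε Q) ∷ []
  tildeRules u@(elim _ _ _ _) = instances u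
  tildeRules u@(neut _ _)     = instances u

  tildeRulesOf : List SRule → List Rule
  tildeRulesOf I = concatMap tildeRules I

  tildeRules-sound : ∀ {I u r} → u ∈ I → r ∈ tildeRules u → Tilde (λ u → u ∈ I) r
  tildeRules-sound {u = intro _ _ _} u∈I (here refl) = keep u∈I isIntro
  tildeRules-sound {u = introε _}    u∈I (here refl) = keep u∈I isIntroε
  tildeRules-sound {u = elim _ _ _ _} u∈I (here refl) = instε u∈I isElim
  tildeRules-sound {u = neut _ _}     u∈I (here refl) = instε u∈I isNeut
  tildeRules-sound {u = u@(elim _ _ _ _)} u∈I (there r∈) with ∈-map⁻ (λ γ → substR (γxT γ) (toRule u)) r∈
  ... | (γ , _ , refl) = instγ γ u∈I isElim
  tildeRules-sound {u = u@(neut _ _)}     u∈I (there r∈) with ∈-map⁻ (λ γ → substR (γxT γ) (toRule u)) r∈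
  ... | (γ , _ , refl) = instγ γ u∈I isNeut

  tildeRulesOf-sound : ∀ I {r} → r ∈ tildeRulesOf I → Tilde (λ u → u ∈ I) r
  tildeRulesOf-sound I r∈ = let (u , u∈I , r∈u) = find (∈-concatMap⁻ tildeRules {xs = I} r∈) in tildeRules-sound u∈I r∈u

  tildeRulesOf-complete : ∀ I {r} → Tilde (λ u → u ∈ I) r → r ∈ tildeRulesOf I
  tildeRulesOf-complete I t = ∈-concatMap⁺ tildeRules (from t)
    where
    instance∈ : ∀ u γ → substR (γxT γ) (toRule u) ∈ map (λ γ → substR (γxT γ) (toRule u)) (allFin nG)
    instance∈ u γ = ∈-map⁺ (λ γ → substR (γxT γ) (toRule u)) (∈-allFin γ)
    from : ∀ {r} → Tilde (λ u → u ∈ I) r → Any (λ u → r ∈ tildeRules u) I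
    from (keep u∈I isIntro)  = lose u∈I (here refl)
    from (keep u∈I isIntroε) = lose u∈I (here refl)
    from (instε u∈I isElim)  = lose u∈I (here refl)
    from (instε u∈I isNeut)  = lose u∈I (here refl)
    from (instγ {u} γ u∈I isElim) = lose u∈I (there (instance∈ u γ))
    from (instγ {u} γ u∈I isNeut) = lose u∈I (there (instance∈ u γ))

  module Refutation (I : List SRule) (N : List Atom) where
    open SaturationDecidable I using (sat?)

    Hyps : List Prop
    Hyps = map neg N

    Provable : Prop → Set
    Provable = Proof (I'Neg I) Hyps

    Has : (State → Set) → Subset nP → Set
    Has Z S = Σ State λ R → R ∈ₛ S × Z R

    has? : ∀ {Z} → Decidable Z → Decidable (Has Z)
    has? Z? S = any? λ R → (R ∈ₛ? S) ×-dec Z? R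

    Refutes : (State → Set) → Stack → State → Set
    Refutes Z γ Q = ∀ V → Sat I (intro γ V Q) → Has Z V

    Escape : (State → Set) → Stack → State → Set
    Escape Z γ Q = Σ (Subset nP) λ V → Sat I (intro γ V Q) × ¬ Has Z V

    refutes-or-escapes : ∀ {Z} → Decidable Z → ∀ γ Q → Refutes Z γ Q ⊎ Escape Z γ Q
    refutes-or-escapes Z? γ Q with allOrCounterexample (finiteSubset nP) (λ V → sat? (intro γ V Q) →-dec has? Z? V)
    ... | inj₁ refutes = inj₁ refutes
    ... | inj₂ (V , ¬refutes) = inj₂ (V , ¬→-split (sat? _) ¬refutes)

    refutes? : ∀ {Z} → Decidable Z → ∀ γ → Decidable (Refutes Z γ)
    refutes? Z? γ Q with refutes-or-escapes Z? γ Q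
    ... | inj₁ refutes = yes refutes
    ... | inj₂ (V , s , ¬has) = no λ refutes → ¬has (refutes V s)

    Ref : Term → State → Set
    Ref (term [] false)     R = ¬ Sat I (introε R)
    Ref (term [] true)      R = atom R xT ∈ N
    Ref (term (γ ∷ w) b)    R = Refutes (Ref (term w b)) γ R

    ref? : ∀ t → Decidable (Ref t)
    ref? (term [] false)  R = ¬? (sat? (introε R))
    ref? (term [] true)   R = member? _≟ᵃ_ (atom R xT) N
    ref? (term (γ ∷ w) b) = refutes? (ref? (term w b)) γ

    Refuted : Atom → Set
    Refuted (atom R t) = Ref t R

    refuted? : Decidable Refuted
    refuted? (atom R t) = ref? t R

    refute-ε : ∀ {R} → ¬ Sat I (introε R) → Provable (neg (atom R εT))
    refute-ε {R} unsat = app (rule [] (neg (atom R εT))) εT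
      (nRule (atom R εT) (cε R) (λ _ → atom R εT) (λ _ t e → ⊥-elim (unsat (tilde-I'-ε t e)))
             [] (λ _ ()) (λ _ t e → ⊥-elim (unsat (tilde-I'-ε t e))))
      []

    -- If every saturated introduction rule for Q(γx) has a premise R(x) with Z R, and
    -- ¬R(σ) is provable whenever Z R, then ¬Q(γσ) is provable: the negative rule for
    -- Q(γx) choosing such a premise from each rule, instantiated at x := σ.
    refute-intro : ∀ {Z γ Q} (σ : Term) → Decidable Z → Refutes Z γ Q →
                   (∀ R → Z R → Provable (neg (atom R σ))) →
                   Provable (neg (atom Q (term (γ ∷ word σ) (hasVar σ))))
    refute-intro {Z} {γ} {Q} σ Z? refutes provable =
      app (rule (map neg chosen) (neg B)) σ (nRule B (cγ Q γ) choose choice∈ chosen chosen⁻ chosen⁺)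
          premises-provable
      where
      B : Atom
      B = atom Q (γxT γ)
      AtX : Atom → Set
      AtX (atom R t) = t ≡ xT × Z R
      atX? : Decidable AtX
      atX? (atom R t) = (t ≟ᵗ xT) ×-dec Z? R
      Saturated : Subset nP → Set
      Saturated V = Sat I (intro γ V Q)
      saturated? : Decidable Saturated
      saturated? V = sat? (intro γ V Q)
      choose : Rule → Atom
      choose r = firstPremise atX? (prems r) B
      chooseFor : Subset nP → Atom
      chooseFor V = choose (toRule (intro γ V Q))
      choose-spec : ∀ V → Saturated V → pos (chooseFor V) ∈ atX V × AtX (chooseFor V)
      choose-spec V s = let (R , R∈V , zR) = refutes V s in
        firstPremise-spec atX? (atX V) B (atom R xT , premiseˣ⁺ R∈V , refl , zR)
      chosen : List Atom
      chosen = map chooseFor (filter saturated? (subsets nP))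
      choice∈ : ∀ r → Tilde (I' I) r → concl r ≡ pos B → pos (choose r) ∈ prems r
      choice∈ r t e with tilde-I'-γ t e
      ... | (V , s , refl) = proj₁ (choose-spec V s)
      chosen⁻ : ∀ a → a ∈ chosen → Σ Rule λ r → Tilde (I' I) r × concl r ≡ pos B × a ≡ choose r
      chosen⁻ a a∈ = let (V , _ , a≡ , s) = ∈-map∘filter⁻ chooseFor saturated? {xs = subsets nP} a∈ in
        toRule (intro γ V Q) , keep (s , isIntro) isIntro , refl , a≡
      chosen⁺ : ∀ r → Tilde (I' I) r → concl r ≡ pos B → choose r ∈ chosen
      chosen⁺ r t e = let (V , s , r≡) = tilde-I'-γ t e in
        subst (λ r → choose r ∈ chosen) (sym r≡) (∈-map∘filter⁺ chooseFor saturated? (V , subsets-complete V , refl , s))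
      chosen-provable : ∀ {V} → Saturated V → Provable (substP σ (neg (chooseFor V)))
      chosen-provable {V} s with chooseFor V | proj₂ (choose-spec V s)
      ... | atom R _ | (refl , zR) = provable R zR
      premises-provable : All Provable (map (substP σ) (map neg chosen))
      premises-provable = map⁺ (map⁺ (map⁺ (mapᴬ chosen-provable (all-filter saturated? (subsets nP)))))

    refuted-provable : ∀ t R → Ref t R → Provable (neg (atom R t))
    refuted-provable (term [] false)  R unsat = refute-ε unsat
    refuted-provable (term [] true)   R R∈N   = hyp (∈-map⁺ neg R∈N)
    refuted-provable (term (γ ∷ w) b) R ref   =
      refute-intro (term w b) (ref? (term w b)) ref (λ R' → refuted-provable (term w b) R')

    NeutClosed : (State → Set) → Set
    NeutClosed Z = ∀ {S P} → Sat I (neut S P) → Z P → Has Z S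

    -- by rule (3) of saturation
    unsat-neutClosed : NeutClosed (λ R → ¬ Sat I (introε R))
    unsat-neutClosed {S} neutS unsatP with has? (λ R → ¬? (sat? (introε R))) S
    ... | yes has = has
    ... | no ¬has = ⊥-elim (unsatP (sat3 (λ Q Q∈S → decidable-stable (sat? _) (λ unsatQ → ¬has (Q , Q∈S , unsatQ))) neutS))

    escapeOf : ∀ {Z γ Q} → Refutes Z γ Q ⊎ Escape Z γ Q → Subset nP
    escapeOf (inj₁ _)       = ∅
    escapeOf (inj₂ (V , _)) = V

    escapeOf-spec : ∀ {Z γ Q} → ¬ Refutes Z γ Q → (c : Refutes Z γ Q ⊎ Escape Z γ Q) →
                    Sat I (intro γ (escapeOf c) Q) × ¬ Has Z (escapeOf c)
    escapeOf-spec ¬refutes (inj₁ refutes)   = ⊥-elim (¬refutes refutes)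
    escapeOf-spec _        (inj₂ (_ , esc)) = esc

    -- by rule (2) of saturation: otherwise every premise Q has a saturated introduction
    -- rule escaping Z, and their combination is a saturated rule for P escaping Z
    refutes-neutClosed : ∀ {Z} → Decidable Z → ∀ γ → NeutClosed (Refutes Z γ)
    refutes-neutClosed {Z} Z? γ {S} neutS refutesP with has? (refutes? Z? γ) S
    ... | yes has = has
    ... | no ¬has = ⊥-elim (escaped (refutesP _ (sat2 f (λ Q Q∈S → proj₁ (escapes Q Q∈S)) neutS)))
      where
      f : State → Subset nP
      f Q = escapeOf (refutes-or-escapes Z? γ Q)
      escapes : ∀ Q → Q ∈ₛ S → Sat I (intro γ (f Q) Q) × ¬ Has Z (f Q)
      escapes Q Q∈S = escapeOf-spec (λ refutesQ → ¬has (Q , Q∈S , refutesQ)) (refutes-or-escapes Z? γ Q)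
      escaped : ¬ Has Z (bigU S f)
      escaped (R , R∈⋃ , zR) = let (Q , Q∈S , R∈fQ) = bigU⁻ S f R∈⋃ in proj₂ (escapes Q Q∈S) (R , R∈fQ , zR)

    -- by rule (1) of saturation: either Z refutes Q through every introduction rule for
    -- γ, or some saturated  P₁(x)⋯Pₘ(x) / Q(γx)  escapes Z and the combined neutral rule
    -- forces a premise of the elimination rule to satisfy Z
    elim-step : ∀ {Z Q γ S P} → Decidable Z → NeutClosed Z → Sat I (elim Q γ S P) → Z P →
                Refutes Z γ Q ⊎ Has Z S
    elim-step Z? closed elimS zP with refutes-or-escapes Z? _ _
    ... | inj₁ refutes = inj₁ refutes
    ... | inj₂ (U , introU , ¬hasU) with closed (sat1 introU elimS) zP
    ... | (R , R∈U∪S , zR) =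
      inj₂ ([ (λ R∈U → ⊥-elim (¬hasU (R , R∈U , zR))) , (λ R∈S → R , R∈S , zR) ] (x∈p∪q⁻ U _ R∈U∪S))

    GoodPremise : Rule → Set
    GoodPremise r = Σ Atom λ a → pos a ∈ prems r × Refuted a

    neut-premise : ∀ {S P} (σ : Term) → NeutClosed (Ref σ) → Sat I (neut S P) → Ref σ P →
                   GoodPremise (substR σ (toRule (neut S P)))
    neut-premise σ closed neutS refP =
      let (R , R∈S , refR) = closed neutS refP in atom R σ , premise⁺ σ R∈S , refR

    elim-premise : ∀ {Q γ S P} (σ : Term) → NeutClosed (Ref σ) → Sat I (elim Q γ S P) → Ref σ P →
                   GoodPremise (substR σ (toRule (elim Q γ S P)))
    elim-premise {Q} {γ} σ closed elimS refP with elim-step (ref? σ) closed elimS refP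
    ... | inj₁ refutesQ = atom Q (term (γ ∷ word σ) (hasVar σ)) , here refl , refutesQ
    ... | inj₂ (R , R∈S , refR) = atom R σ , there (premise⁺ σ R∈S) , refR

    good-premise : ∀ {A} → InC A → Refuted A → ∀ r → Tilde (λ u → u ∈ I) r → concl r ≡ pos A → GoodPremise r
    good-premise (cε P)   unsatP _ (keep u∈I isIntroε) refl = ⊥-elim (unsatP (base u∈I))
    good-premise (cε P)   unsatP _ (instε u∈I isNeut) refl = neut-premise εT unsat-neutClosed (base u∈I) unsatP
    good-premise (cε P)   unsatP _ (instε u∈I isElim) refl = elim-premise εT unsat-neutClosed (base u∈I) unsatP
    good-premise (cγ P γ) refutesP _ (keep u∈I isIntro) refl =
      let (R , R∈S , R∈N) = refutesP _ (base u∈I) in atom R xT , premiseˣ⁺ R∈S , R∈N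
    good-premise (cγ P γ) refutesP _ (instγ _ u∈I isNeut) refl =
      neut-premise (γxT γ) (refutes-neutClosed (ref? xT) γ) (base u∈I) refutesP
    good-premise (cγ P γ) refutesP _ (instγ _ u∈I isElim) refl =
      elim-premise (γxT γ) (refutes-neutClosed (ref? xT) γ) (base u∈I) refutesP
    good-premise (cε P)   _ _ (keep _ isIntro) ()
    good-premise (cε P)   _ _ (instγ _ _ isNeut) ()
    good-premise (cε P)   _ _ (instγ _ _ isElim) ()
    good-premise (cγ P γ) _ _ (keep _ isIntroε) ()
    good-premise (cγ P γ) _ _ (instε _ isNeut) ()
    good-premise (cγ P γ) _ _ (instε _ isElim) ()

    negative-rule : ∀ {A} → InC A → Refuted A →
                    Σ (List Atom) λ Cs → INeg I (rule (map neg Cs) (neg A)) × All (λ C → Provable (neg C)) Cs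
    negative-rule {A} c refutedA = Cs , nRule A c choose (λ r t e → proj₁ (choose-spec r t e)) Cs Cs⁻ Cs⁺ ,
                                   tabulateᴬ (λ {C} C∈Cs → chosen-provable C C∈Cs)
      where
      choose : Rule → Atom
      choose r = firstPremise refuted? (prems r) A
      choose-spec : ∀ r → Tilde (λ u → u ∈ I) r → concl r ≡ pos A → pos (choose r) ∈ prems r × Refuted (choose r)
      choose-spec r t e = firstPremise-spec refuted? (prems r) A (good-premise c refutedA r t e)
      Concludes : Rule → Set
      Concludes r = concl r ≡ pos A
      concludes? : Decidable Concludes
      concludes? r = isPos? (concl r) A
      Cs : List Atom
      Cs = map choose (filter concludes? (tildeRulesOf I))
      Cs⁻ : ∀ C → C ∈ Cs → Σ Rule λ r → Tilde (λ u → u ∈ I) r × concl r ≡ pos A × C ≡ choose r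
      Cs⁻ C C∈Cs with ∈-map∘filter⁻ choose concludes? {xs = tildeRulesOf I} C∈Cs
      ... | (r , r∈ , refl , e) = r , tildeRulesOf-sound I r∈ , e , refl
      Cs⁺ : ∀ r → Tilde (λ u → u ∈ I) r → concl r ≡ pos A → choose r ∈ Cs
      Cs⁺ r t e = ∈-map∘filter⁺ choose concludes? (r , tildeRulesOf-complete I t , refl , e)
      chosen-provable : ∀ C → C ∈ Cs → Provable (neg C)
      chosen-provable C C∈Cs with Cs⁻ C C∈Cs
      ... | (r , t , e , refl) = refuted-provable _ _ (proj₂ (choose-spec r t e))

    -- A negative rule  ¬N / ¬A  of 𝓘'¬ makes its conclusion A ∈ 𝒞 refuted: its chosen
    -- premises witness that every rule of 𝓘' concluding A has a premise in N.
    conclusion-refuted : ∀ {A} → I'Neg I (rule (map neg N) (neg A)) → InC A × Refuted A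
    conclusion-refuted rule∈ = inversion rule∈ refl refl
      where
      inversion : ∀ {r A} → I'Neg I r → concl r ≡ neg A → prems r ≡ map neg N → InC A × Refuted A
      inversion (pRule {intro _ _ _} _) () _
      inversion (pRule {introε _} _) () _
      inversion (pRule {elim _ _ _ _} _) () _
      inversion (pRule {neut _ _} _) () _
      inversion (nRule B c f f∈ N' _ N'⁺) refl premises
        with refl ← map-injective (λ { refl → refl }) premises = c , refuted c
        where
        refuted : InC B → Refuted B
        refuted (cε P) sat with () ← f∈ _ (keep (sat , isIntroε) isIntroε) refl
        refuted (cγ P γ) V sat with premise⁻ V (f∈ _ (keep (sat , isIntro) isIntro) refl)
        ... | (R , R∈V , e) = R , R∈V , subst (_∈ N) e (N'⁺ _ (keep (sat , isIntro) isIntro) refl)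

lemma10 : (nP nG : ℕ) → let open APDS nP nG in
    (I : List SRule) (Bs : List Atom) (A : Atom) →
    I'Neg I (rule (map neg Bs) (neg A)) →
    Σ (List Atom) λ Cs →
    INeg I (rule (map neg Cs) (neg A)) ×
    All (λ C → Proof (I'Neg I) (map neg Bs) (neg C)) Cs
lemma10 nP nG I Bs A rule∈I'¬ =
  let open Refutation {nP} {nG} I Bs
      (A∈𝒞 , refutedA) = conclusion-refuted rule∈I'¬
  in negative-rule A∈𝒞 refutedA
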